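{- Let $\mathcal{A}$ be a partial combinatory algebra and let $A=\{a\in\mathcal{A}: aa\downarrow=\bar 0\}$ and $B=\{a\in\mathcal{A}: aa\downarrow=\bar 1\}$. Then $A$ and $B$ are computably inseparable in $\mathcal{A}$: there is no set $C\subseteq\mathcal{A}$ decidable in $\mathcal{A}$ with $A\subseteq C\subseteq\mathcal{A}\setminus B$.
   Context: A pca $\mathcal{A}$ is a set with a partial, left-associative, strict application that is combinatory complete; equivalently it has $k,s$ with $kab=a$, $sab\downarrow$, $sabc\simeq ac(bc)$. With combinatory abstraction $\lambda^*$, put $i=skk$, $\mathsf{true}=k$, $\mathsf{false}=ki$, $\langle a,b\rangle=\lambda^*z.zab$, and numerals $\bar 0=i$, $\overline{n+1}=\langle\mathsf{false},\bar n\rangle$. $aa\downarrow=x$ means $aa$ is defined and equals $x$. A set $C$ is decidable in $\mathcal{A}$ if there is $c\in\mathcal{A}$ with $ca$ defined for all $a$, $ca=\mathsf{true}$ iff $a\in C$ and $ca=\mathsf{false}$ iff $a\notin C$ (equivalently, using values $\bar 1$ and $\bar 0$ instead). -}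

module Defs where

open import Level using (Level; suc; _⊔_)
open import Data.Product using (Σ; ∃; _×_; _,_; proj₁; proj₂)
open import Relation.Binary.PropositionalEquality using (_≡_)
open import Relation.Nullary using (¬_)

infix 4 _↔_
_↔_ : ∀ {a b} → Set a → Set b → Set (a ⊔ b)
P ↔ Q = (P → Q) × (Q → P)

-- Partial application is a functional
-- ternary relation:  App a b x  means "a b is defined and equals x".
record PCA (ℓ : Level) : Set (suc ℓ) where
  field
    Carrier : Set ℓ
    App     : Carrier → Carrier → Carrier → Set ℓ
    App-functional : ∀ {a b x y} → App a b x → App a b y → x ≡ y
    k : Carrier
    s : Carrier
    k-def  : ∀ a → ∃ λ ka → App k a ka
    k-ax   : ∀ a b ka → App k a ka → App ka b a
    s-def₁ : ∀ a → ∃ λ sa → App s a sa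
    s-def₂ : ∀ a b sa → App s a sa → ∃ λ sab → App sa b sab
    -- s a b c ≃ a c (b c)  (Kleene equality)
    s-ax   : ∀ a b c sa sab → App s a sa → App sa b sab →
             ∀ x → (App sab c x ↔ (∃ λ ac → ∃ λ bc → App a c ac × App b c bc × App ac bc x))

module PCAElems {ℓ : Level} (𝒜 : PCA ℓ) where
  open PCA 𝒜

  k· : Carrier → Carrier
  k· a = proj₁ (k-def a)

  s·· : Carrier → Carrier → Carrier
  s·· a b = proj₁ (s-def₂ a b (proj₁ (s-def₁ a)) (proj₂ (s-def₁ a)))

  i : Carrier
  i = s·· k k

  true false : Carrier
  true  = k
  false = k· i

  -- ⟨a,b⟩ = λ*z. z a b = s (s i (k a)) (k b)   (standard combinatory abstraction)
  ⟨_,_⟩ : Carrier → Carrier → Carrier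
  ⟨ a , b ⟩ = s·· (s·· i (k· a)) (k· b)

  open import Data.Nat using (ℕ; zero) renaming (suc to sucℕ)
  num : ℕ → Carrier
  num zero     = i
  num (sucℕ n) = ⟨ false , num n ⟩

  Decidable-in : (Carrier → Set ℓ) → Set ℓ
  Decidable-in C = ∃ λ c → ∀ a →
    (∃ λ r → App c a r) ×
    (App c a true ↔ C a) ×
    (App c a false ↔ (¬ C a))

  A-set B-set : Carrier → Set ℓ
  A-set a = App a a (num 0)
  B-set a = App a a (num 1)

  ComputablyInseparable : (Carrier → Set ℓ) → (Carrier → Set ℓ) → Set (suc ℓ)
  ComputablyInseparable P Q =
    ¬ (∃ λ (C : Carrier → Set ℓ) → Decidable-in C ×
         (∀ a → P a → C a) × (∀ a → C a → ¬ Q a))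

module Submission where

-- Proof idea (a diagonal argument).  Suppose C separates A from B and is
-- decided by c.  Using combinatory completeness, build the element
--     d = λ*a. c a 1̄ 0̄   (that is, s (s (s (k c) i) (k 1̄)) (k 0̄)),
-- so that d a ≃ c a 1̄ 0̄; since true x y = x and false x y = y, d answers 1̄
-- on members of C and 0̄ on non-members.  Apply d to itself: if d ∈ C then
-- d d = 1̄, i.e. d ∈ B, contradicting C ∩ B = ∅; hence d ∉ C, so d d = 0̄,
-- i.e. d ∈ A ⊆ C, a contradiction.

open import Defs
open import Level using (Level)
open import Data.Product using (∃; _×_; _,_; proj₁; proj₂)
open import Relation.Nullary using (¬_)

module Combinators {ℓ : Level} (𝒜 : PCA ℓ) where
  open PCA 𝒜
  open PCAElems 𝒜

  k-app : ∀ a b → App (k· a) b a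
  k-app a b = k-ax a b (k· a) (proj₂ (k-def a))

  s-app : ∀ a b c ac bc x →
          App a c ac → App b c bc → App ac bc x → App (s·· a b) c x
  s-app a b c ac bc x a·c b·c ac·bc =
    proj₂ (s-ax a b c sa (s·· a b) s·a (proj₂ (s-def₂ a b sa s·a)) x)
          (ac , bc , a·c , b·c , ac·bc)
    where
      sa : Carrier
      sa = proj₁ (s-def₁ a)
      s·a : App s a sa
      s·a = proj₂ (s-def₁ a)

  i-app : ∀ a → App i a a
  i-app a = s-app k k a (k· a) (k· a) a (proj₂ (k-def a)) (proj₂ (k-def a))
                  (k-app a (k· a))

  true-selects : ∀ u v → ∃ λ tu → App true u tu × App tu v u
  true-selects u v = k· u , proj₂ (k-def u) , k-app u v

  false-selects : ∀ u v → ∃ λ fu → App false u fu × App fu v v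
  false-selects u v = i , k-app i u , i-app v

  -- The case-split combinator  case c u v = λ*a. c a u v.
  case : Carrier → Carrier → Carrier → Carrier
  case c u v = s·· (s·· (s·· (k· c) i) (k· u)) (k· v)

  case-app : ∀ c u v a y z x →
             App c a y → App y u z → App z v x → App (case c u v) a x
  case-app c u v a y z x c·a y·u z·v =
    s-app _ (k· v) a z v x
      (s-app _ (k· u) a y u z
        (s-app (k· c) i a c a y (k-app c a) (i-app a) c·a)
        (k-app u a) y·u)
      (k-app v a) z·v

  case-select : ∀ c u v a b w → App c a b →
                (∃ λ bu → App b u bu × App bu v w) → App (case c u v) a w
  case-select c u v a b w c·a (bu , b·u , bu·v) = case-app c u v a b bu w c·a b·u bu·v

module Diagonal {ℓ : Level} (𝒜 : PCA ℓ) where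
  open PCA 𝒜
  open PCAElems 𝒜
  open Combinators 𝒜

  diagonal : (C : Carrier → Set ℓ) → Decidable-in C →
             ∃ λ d → (C d → B-set d) × (¬ C d → A-set d)
  diagonal C (c , decides) = d , in-C , not-in-C
    where
      d : Carrier
      d = case c (num 1) (num 0)

      in-C : C d → App d d (num 1)
      in-C Cd = case-select c (num 1) (num 0) d true (num 1)
                  (proj₂ (proj₁ (proj₂ (decides d))) Cd) (true-selects (num 1) (num 0))

      not-in-C : ¬ C d → App d d (num 0)
      not-in-C ¬Cd = case-select c (num 1) (num 0) d false (num 0)
                       (proj₂ (proj₂ (proj₂ (decides d))) ¬Cd) (false-selects (num 1) (num 0))

-- The diagonal element of a separating set would lie neither in C nor outside it.
proposition7p2 : ∀ {ℓ : Level} (𝒜 : PCA ℓ) → let open PCAElems 𝒜 in ComputablyInseparable A-set B-set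
proposition7p2 𝒜 (C , C-decidable , A⊆C , C∩B=∅) = refute (diagonal C C-decidable)
  where
    open PCAElems 𝒜
    open Diagonal 𝒜

    refute : ¬ (∃ λ d → (C d → B-set d) × (¬ C d → A-set d))
    refute (d , to-B , to-A) = d∉C (A⊆C d (to-A d∉C))
      where
        d∉C : ¬ C d
        d∉C Cd = C∩B=∅ d Cd (to-B Cd)
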